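{- Let $G=(U,W,E)$ be a convex bipartite graph with $|U|\ge 2$ and $|W|\ge 2$, with convex ordering $w_1,\dots,w_{|W|}$ of $W$, and let $D$ be a minimal connected dominating set of $G$. Then for every $i$ with $1\le i\le |W|-1$ there exists a vertex $u\in D\cap U$ such that $u\in N(w_i)\cap N(w_{i+1})$.
   Context: All graphs are finite, undirected, simple; $N(v)$ denotes the set of neighbors of $v$. A bipartite graph $G=(U,W,E)$ is convex if there is an ordering $w_1,\dots,w_{|W|}$ of $W$ such that for every $u\in U$ the neighborhood $N(u)\subseteq W$ is a set of consecutive vertices in this ordering. A set $D\subseteq V(G)$ is a connected dominating set if $G[D]$ is connected and every vertex of $G$ is in $D$ or has a neighbor in $D$; it is minimal if no proper subset of it is a connected dominating set. -}

module Defs where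

open import Data.Nat using (ℕ; _≤_)
open import Data.Fin using (Fin; toℕ)
open import Data.Bool using (Bool; true; false)
open import Data.Sum using (_⊎_; inj₁; inj₂)
open import Data.Product using (_×_; ∃; ∃-syntax; Σ-syntax)
open import Data.Empty using (⊥)
open import Relation.Binary.PropositionalEquality using (_≡_)

-- A bipartite graph G = (U, W, E) with U = Fin m, W = Fin n and
-- edge relation E : U → W → Bool (u adjacent to w iff E u w ≡ true).
record BipGraph (m n : ℕ) : Set where
  field
    E : Fin m → Fin n → Bool

open BipGraph public

Vertex : ℕ → ℕ → Set
Vertex m n = Fin m ⊎ Fin n

Adj : ∀ {m n} → BipGraph m n → Vertex m n → Vertex m n → Set
Adj G (inj₁ u) (inj₁ u') = ⊥
Adj G (inj₁ u) (inj₂ w)  = E G u w ≡ true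
Adj G (inj₂ w) (inj₁ u)  = E G u w ≡ true
Adj G (inj₂ w) (inj₂ w') = ⊥

-- The given ordering w_1,...,w_n of W is the natural order of Fin n.
-- G is convex w.r.t. this ordering: every N(u) is a set of consecutive
-- vertices, i.e. an interval of Fin n.
IsConvex : ∀ {m n} → BipGraph m n → Set
IsConvex {m} {n} G =
  (u : Fin m) (a b c : Fin n) → toℕ a ≤ toℕ b → toℕ b ≤ toℕ c →
  E G u a ≡ true → E G u c ≡ true → E G u b ≡ true

VSet : ℕ → ℕ → Set
VSet m n = Vertex m n → Bool

_∈ₛ_ : ∀ {m n} → Vertex m n → VSet m n → Set
v ∈ₛ D = D v ≡ true

data WalkIn {m n} (G : BipGraph m n) (D : VSet m n) : Vertex m n → Vertex m n → Set where
  here : ∀ {x} → x ∈ₛ D → WalkIn G D x x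
  step : ∀ {x y z} → x ∈ₛ D → Adj G x y → WalkIn G D y z → WalkIn G D x z

InducedConnected : ∀ {m n} → BipGraph m n → VSet m n → Set
InducedConnected G D = ∀ x y → x ∈ₛ D → y ∈ₛ D → WalkIn G D x y

Dominating : ∀ {m n} → BipGraph m n → VSet m n → Set
Dominating G D = ∀ v → v ∈ₛ D ⊎ (∃[ x ] (x ∈ₛ D × Adj G v x))

IsCDS : ∀ {m n} → BipGraph m n → VSet m n → Set
IsCDS G D = InducedConnected G D × Dominating G D

ProperSubset : ∀ {m n} → VSet m n → VSet m n → Set
ProperSubset D' D = (∀ v → v ∈ₛ D' → v ∈ₛ D) × (∃[ v ] (v ∈ₛ D × D' v ≡ false))

IsMinimalCDS : ∀ {m n} → BipGraph m n → VSet m n → Set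
IsMinimalCDS G D = IsCDS G D × (∀ D' → ProperSubset D' D → IsCDS G D' → ⊥)

module Submission where

open import Defs
open import Data.Nat using (ℕ; _≤_; suc)
open import Data.Nat.Properties using (≤-refl; ≤-trans; ≰⇒>; _≤?_; n≤1+n; 1+n≰n)
open import Data.Fin using (Fin; toℕ)
open import Data.Fin.Properties using (all?; ¬∀⟶∃¬)
open import Data.Bool using (true)
open import Data.Bool.Properties using () renaming (_≟_ to _≟ᵇ_)
open import Data.Sum using (inj₁; inj₂)
open import Data.Product using (_×_; _,_; ∃-syntax; ∃₂)
open import Level using (Level)
open import Relation.Unary using (Pred; Decidable)
open import Relation.Nullary using (¬_; yes; no; contradiction; _→-dec_)
open import Relation.Binary.PropositionalEquality using (_≡_; _≢_; refl; sym; subst; ≢-sym)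

-- A walk in G[D] from the ordering's side "up to wᵢ" to the side beyond it must use an
-- edge {w, u} with w ≤ wᵢ and u ∈ D having a neighbour ≥ wᵢ₊₁; by convexity N(u) then
-- contains both wᵢ and wᵢ₊₁. Such walks exist since wᵢ and wᵢ₊₁ have U-neighbours in D.

module _ {m n : ℕ} (G : BipGraph m n) (D : VSet m n) where

  walk-source-∈ : ∀ {x z} → WalkIn G D x z → x ∈ₛ D
  walk-source-∈ (here x∈D)     = x∈D
  walk-source-∈ (step x∈D _ _) = x∈D

  walk-exits : ∀ {ℓ : Level} {P : Pred (Vertex m n) ℓ} → Decidable P →
    ∀ {x z} → WalkIn G D x z → P x → ¬ P z →
    ∃₂ λ a b → a ∈ₛ D × b ∈ₛ D × Adj G a b × P a × ¬ P b
  walk-exits P? (here _) px ¬pz = contradiction px ¬pz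
  walk-exits P? (step {y = y} x∈D xy walk) px ¬pz with P? y
  ... | yes py = walk-exits P? walk py ¬pz
  ... | no ¬py = _ , _ , x∈D , walk-source-∈ walk , xy , px , ¬py

  walk-from-W-enters-U : ∀ {w z} → WalkIn G D (inj₂ w) z → inj₂ w ≢ z →
    ∃[ u ] (inj₁ u ∈ₛ D × E G u w ≡ true)
  walk-from-W-enters-U (here _) w≢z = contradiction refl w≢z
  walk-from-W-enters-U (step {y = inj₁ u} _ wu walk) _ = u , walk-source-∈ walk , wu

  -- The second vertex w' only serves to give G[D] a vertex other than w when w ∈ D.
  U-neighbour-in : IsCDS G D → ∀ w w' → w ≢ w' → ∃[ u ] (inj₁ u ∈ₛ D × E G u w ≡ true)
  U-neighbour-in (connected , dominating) w w' w≢w' with dominating (inj₂ w)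
  ... | inj₂ (inj₁ u , u∈D , wu) = u , u∈D , wu
  ... | inj₁ w∈D with dominating (inj₂ w')
  ...   | inj₁ w'∈D =
          walk-from-W-enters-U (connected _ _ w∈D w'∈D) λ { refl → w≢w' refl }
  ...   | inj₂ (inj₁ u , u∈D , _) =
          walk-from-W-enters-U (connected (inj₂ w) (inj₁ u) w∈D u∈D) λ ()

module Cut {m n : ℕ} {G : BipGraph m n} (convex : IsConvex G)
           (i j : Fin n) (j≡1+i : toℕ j ≡ suc (toℕ i)) where

  UpTo : Vertex m n → Set
  UpTo (inj₁ u) = ∀ w → E G u w ≡ true → toℕ w ≤ toℕ i
  UpTo (inj₂ w) = toℕ w ≤ toℕ i

  bounded? : ∀ u → Decidable λ w → E G u w ≡ true → toℕ w ≤ toℕ i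
  bounded? u w = (E G u w ≟ᵇ true) →-dec (toℕ w ≤? toℕ i)

  upTo? : Decidable UpTo
  upTo? (inj₁ u) = all? (bounded? u)
  upTo? (inj₂ w) = toℕ w ≤? toℕ i

  i≤j : toℕ i ≤ toℕ j
  i≤j = subst (toℕ i ≤_) (sym j≡1+i) (n≤1+n (toℕ i))

  i≢j : i ≢ j
  i≢j refl = 1+n≰n (subst (_≤ toℕ i) j≡1+i ≤-refl)

  neighbour-beyond : ∀ {u} → ¬ UpTo (inj₁ u) → ∃[ w ] (E G u w ≡ true × toℕ j ≤ toℕ w)
  neighbour-beyond {u} ¬upTo with ¬∀⟶∃¬ _ _ (bounded? u) ¬upTo
  ... | w , ¬bounded with E G u w ≟ᵇ true
  ...   | yes uw = w , uw , subst (_≤ toℕ w) (sym j≡1+i) (≰⇒> λ w≤i → ¬bounded λ _ → w≤i)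
  ...   | no ¬uw = contradiction (λ uw → contradiction uw ¬uw) ¬bounded

  straddles : ∀ {u w} → E G u w ≡ true → toℕ w ≤ toℕ i → ¬ UpTo (inj₁ u) →
    E G u i ≡ true × E G u j ≡ true
  straddles {u} {w} uw w≤i ¬upTo with neighbour-beyond ¬upTo
  ... | w' , uw' , j≤w' =
    convex u w i w' w≤i (≤-trans i≤j j≤w') uw uw' ,
    convex u w j w' (≤-trans w≤i i≤j) j≤w' uw uw'

  boundary-edge-straddles : ∀ {a b} → Adj G a b → UpTo a → ¬ UpTo b →
    ∃[ u ] (b ≡ inj₁ u × E G u i ≡ true × E G u j ≡ true)
  boundary-edge-straddles {inj₁ u} {inj₂ w} uw upTo ¬upTo = contradiction (upTo w uw) ¬upTo
  boundary-edge-straddles {inj₂ w} {inj₁ u} uw upTo ¬upTo = u , refl , straddles uw upTo ¬upTo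

  cds-bridges : ∀ D → IsCDS G D → ∃[ u ] (inj₁ u ∈ₛ D × E G u i ≡ true × E G u j ≡ true)
  cds-bridges D cds@(connected , _)
    with U-neighbour-in G D cds i j i≢j | U-neighbour-in G D cds j i (≢-sym i≢j)
  ... | uᵢ , uᵢ∈D , uᵢi | uⱼ , uⱼ∈D , uⱼj with upTo? (inj₁ uᵢ)
  ...   | no ¬upTo = uᵢ , uᵢ∈D , straddles uᵢi ≤-refl ¬upTo
  ...   | yes upTo
    with walk-exits G D upTo? (connected (inj₁ uᵢ) (inj₁ uⱼ) uᵢ∈D uⱼ∈D) upTo
           (λ upToⱼ → 1+n≰n (subst (_≤ toℕ i) j≡1+i (upToⱼ j uⱼj)))
  ...     | _ , _ , _ , b∈D , ab , upTo-a , ¬upTo-b with boundary-edge-straddles ab upTo-a ¬upTo-b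
  ...       | u , refl , ui , uj = u , b∈D , ui , uj

mainTheorem5 : (m n : ℕ) → 2 ≤ m → 2 ≤ n → (G : BipGraph m n) → IsConvex G →
    (D : VSet m n) → IsMinimalCDS G D →
    (i j : Fin n) → toℕ j ≡ suc (toℕ i) →
    ∃[ u ] (inj₁ u ∈ₛ D × E G u i ≡ true × E G u j ≡ true)
mainTheorem5 m n _ _ G convex D (cds , _) i j j≡1+i = Cut.cds-bridges convex i j j≡1+i D cds
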